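{- Let $G$ be a group and let $L,R$ be nonempty subsets of $G$. The two-sided group digraph $2\mathrm{S}(G;L,R)$ is strongly connected if and only if $G=\mathcal{W}(L^{ -1})\mathcal{W}(R)=\mathcal{W}(L)\mathcal{W}(R^{ -1})$ and there exist $i,j\in\mathbb{N}$ such that $e=w_{L^{ -1},i+1}w_{R,i}$ for some word $w_{L^{ -1},i+1}$ in $L^{ -1}$ of length $i+1$ and some word $w_{R,i}$ in $R$ of length $i$, and $e=w_{L^{ -1},j}w_{R,j+1}$ for some word $w_{L^{ -1},j}$ in $L^{ -1}$ of length $j$ and some word $w_{R,j+1}$ in $R$ of length $j+1$.
   Context: For a group $G$ with identity $e$ and nonempty subsets $L,R\subseteq G$, the two-sided group digraph $2\mathrm{S}(G;L,R)$ has vertex set $G$ and a directed arc $(g,h)$ from $g$ to $h$ if and only if $h=l^{ -1}gr$ for some $l\in L$ and $r\in R$ (no multiple arcs). For a nonempty subset $S\subseteq G$, a word in $S$ of length $n>0$ is a product $s_1s_2\cdots s_n$ with $s_1,\dots,s_n\in S$ (not necessarily distinct); $w_{S,n}$ denotes (the group element given by) a word in $S$ of length $n$, and $\mathcal{W}(S)$ is the set of all elements of $G$ given by words in $S$ of finite positive length. For subsets $A,B$, $AB=\{ab: a\in A, b\in B\}$, and $S^{ -1}=\{s^{ -1}:s\in S\}$. A digraph is strongly connected if for every ordered pair of vertices $g,h$ there is a directed path from $g$ to $h$. -}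

module Defs where

open import Level using (Level; _⊔_; suc)
open import Algebra.Bundles using (Group)
open import Data.Nat using (ℕ; _<_)
open import Data.Vec using (Vec; foldr′)
open import Data.Vec.Relation.Unary.All using (All)
open import Data.Product using (Σ; ∃; _×_)
open import Relation.Unary using (Pred)

module _ {c ℓ : Level} (G : Group c ℓ) where
  open Group G

  Inv : ∀ {p} → Pred Carrier p → Pred Carrier (c ⊔ ℓ ⊔ p)
  Inv S x = Σ Carrier λ s → S s × x ≈ s ⁻¹

  prod : ∀ {n} → Vec Carrier n → Carrier
  prod = foldr′ _∙_ ε

  IsWord : ∀ {p} → Pred Carrier p → ℕ → Pred Carrier (c ⊔ ℓ ⊔ p)
  IsWord S n g = (0 < n) × Σ (Vec Carrier n) λ xs → All S xs × g ≈ prod xs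

  𝒲 : ∀ {p} → Pred Carrier p → Pred Carrier (c ⊔ ℓ ⊔ p)
  𝒲 S g = Σ ℕ λ n → IsWord S n g

  _·_ : ∀ {p q} → Pred Carrier p → Pred Carrier q → Pred Carrier (c ⊔ ℓ ⊔ p ⊔ q)
  (A · B) g = Σ Carrier λ a → Σ Carrier λ b → A a × B b × g ≈ a ∙ b

  Arc : ∀ {p q} → Pred Carrier p → Pred Carrier q → Carrier → Carrier → Set (c ⊔ ℓ ⊔ p ⊔ q)
  Arc L R g h = Σ Carrier λ l → Σ Carrier λ r → L l × R r × h ≈ (l ⁻¹ ∙ g) ∙ r

  data Path {p q} (L : Pred Carrier p) (R : Pred Carrier q) : Carrier → Carrier → Set (c ⊔ ℓ ⊔ p ⊔ q) where
    here : ∀ {g h} → g ≈ h → Path L R g h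
    step : ∀ {g h k} → Arc L R g h → Path L R h k → Path L R g k

  StronglyConnected : ∀ {p q} → Pred Carrier p → Pred Carrier q → Set (c ⊔ ℓ ⊔ p ⊔ q)
  StronglyConnected L R = ∀ g h → Path L R g h

  IsAll : ∀ {p} → Pred Carrier p → Set (c ⊔ p)
  IsAll A = ∀ g → A g

module Submission where

-- Write  Reach u v g h  when h = a g b for a word a of length u in L⁻¹ and a
-- word b of length v in R (lengths may be 0).  An arc g → l⁻¹ g r is exactly Reach 1 1 and
-- Reach composes by concatenating words, so a path of length n from g to h is the same as
-- Reach n n g h (Path⇒Reach, Reach⇒Path).  Unbalanced relations  Loop u v = Reach u v e e
-- are identity equations x y = e with |x| = u, |y| = v; the conditions on i and j in the
-- theorem say precisely that Loop (i+1) i and Loop j (j+1) hold.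
--   (⇒) Prefixing one arc gives every pair of vertices a Reach with positive lengths.
--       Reach from e to h is a factorisation h ∈ 𝒲(L⁻¹)𝒲(R), Reach from g to e is a
--       factorisation g ∈ 𝒲(L)𝒲(R⁻¹), and following the paths e → l and e → r⁻¹ by the
--       cancellations Reach 1 0 l e and Reach 0 1 r⁻¹ e produces the two loops.
--   (⇐) Factorisations give g ⇝ e and e ⇝ h with possibly unequal lengths; inserting
--       suitable powers of the two loops at e balances them (connect-via-ε).

open import Defs
open import Level using (Level; _⊔_)
open import Algebra.Bundles using (Group)
open import Data.Nat using (ℕ; suc; zero; _+_; _*_; z≤n; s≤s)
open import Data.Nat.Properties using (+-comm; +-identityʳ)
open import Data.Nat.Tactic.RingSolver using (solve-∀)
open import Data.Product using (Σ; _×_; _,_; proj₂)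
open import Data.Vec using (Vec; []; _∷_; _++_)
open import Data.Vec.Relation.Unary.All using (All; []; _∷_)
open import Data.Vec.Relation.Unary.All.Properties using (++⁺)
open import Relation.Unary using (Pred)
open import Relation.Binary.PropositionalEquality as P using (_≡_)
open import Function.Bundles using (_⇔_; mk⇔)
open import Tactic.MonoidSolver using (solve)

module Words {c ℓ : Level} (G : Group c ℓ) where
  open Group G
  open import Algebra.Properties.Group G using (ε⁻¹≈ε; ⁻¹-anti-homo-∙; ⁻¹-involutive)
  open import Relation.Binary.Reasoning.Setoid setoid

  Word : ∀ {r} → Pred Carrier r → ℕ → Pred Carrier (c ⊔ ℓ ⊔ r)
  Word S n a = Σ (Vec Carrier n) λ xs → All S xs × a ≈ prod G xs

  private variable
    r t : Level
    S : Pred Carrier r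
    T : Pred Carrier t

  Word-resp : ∀ {n a b} → a ≈ b → Word S n a → Word S n b
  Word-resp a≈b (xs , Sxs , a≈xs) = xs , Sxs , trans (sym a≈b) a≈xs

  Word-cast : ∀ {m n a} → m ≡ n → Word S m a → Word S n a
  Word-cast P.refl w = w

  Word-ε : Word S 0 ε
  Word-ε = [] , [] , refl

  Word-letter : ∀ {s} → S s → Word S 1 s
  Word-letter Ss = _ ∷ [] , Ss ∷ [] , sym (identityʳ _)

  prod-++ : ∀ {m n} (xs : Vec Carrier m) (ys : Vec Carrier n) →
            prod G (xs ++ ys) ≈ prod G xs ∙ prod G ys
  prod-++ []       ys = sym (identityˡ _)
  prod-++ (x ∷ xs) ys = trans (∙-congˡ (prod-++ xs ys)) (sym (assoc _ _ _))

  Word-++ : ∀ {m n a b} → Word S m a → Word S n b → Word S (m + n) (a ∙ b)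
  Word-++ (xs , Sxs , a≈) (ys , Sys , b≈) =
    xs ++ ys , ++⁺ Sxs Sys , trans (∙-cong a≈ b≈) (sym (prod-++ xs ys))

  Word-snoc : ∀ {n a s} → Word S n a → S s → Word S (suc n) (a ∙ s)
  Word-snoc {n = n} w Ss = Word-cast (+-comm n 1) (Word-++ w (Word-letter Ss))

  Word-unsnoc : ∀ {n a} → Word S (suc n) a →
                Σ Carrier λ a′ → Σ Carrier λ s → Word S n a′ × S s × a ≈ a′ ∙ s
  Word-unsnoc (x ∷ [] , Sx ∷ [] , a≈) =
    ε , x , Word-ε , Sx , trans a≈ (trans (identityʳ x) (sym (identityˡ x)))
  Word-unsnoc {a = a} (x ∷ y ∷ xs , Sx ∷ Syxs , a≈) with Word-unsnoc (y ∷ xs , Syxs , refl)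
  ... | a′ , s , w , Ss , rest≈ = x ∙ a′ , s , Word-++ (Word-letter Sx) w , Ss , a≈xa′s
    where
    a≈xa′s : a ≈ (x ∙ a′) ∙ s
    a≈xa′s = begin
      a                    ≈⟨ a≈ ⟩
      x ∙ prod G (y ∷ xs)  ≈⟨ ∙-congˡ rest≈ ⟩
      x ∙ (a′ ∙ s)         ≈⟨ assoc x a′ s ⟨
      (x ∙ a′) ∙ s         ∎

  Word-inv : (∀ {x} → S x → Σ Carrier λ y → T y × x ⁻¹ ≈ y) →
             ∀ {n a} → Word S n a → Word T n (a ⁻¹)
  Word-inv f ([] , [] , a≈ε) = Word-resp (sym (trans (⁻¹-cong a≈ε) ε⁻¹≈ε)) Word-ε
  Word-inv f {a = a} (x ∷ xs , Sx ∷ Sxs , a≈) with f Sx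
  ... | y , Ty , x⁻¹≈y = Word-resp reversed (Word-snoc (Word-inv f (xs , Sxs , refl)) Ty)
    where
    reversed : prod G xs ⁻¹ ∙ y ≈ a ⁻¹
    reversed = begin
      prod G xs ⁻¹ ∙ y       ≈⟨ ∙-congˡ x⁻¹≈y ⟨
      prod G xs ⁻¹ ∙ x ⁻¹    ≈⟨ ⁻¹-anti-homo-∙ x (prod G xs) ⟨
      (x ∙ prod G xs) ⁻¹     ≈⟨ ⁻¹-cong a≈ ⟨
      a ⁻¹                   ∎

  inv-letter : ∀ {x} → S x → Σ Carrier λ y → Inv G S y × x ⁻¹ ≈ y
  inv-letter {x = x} Sx = x ⁻¹ , (x , Sx , refl) , refl

  uninv-letter : ∀ {x} → Inv G S x → Σ Carrier λ y → S y × x ⁻¹ ≈ y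
  uninv-letter (s , Ss , x≈s⁻¹) = s , Ss , trans (⁻¹-cong x≈s⁻¹) (⁻¹-involutive s)

  toIsWord : ∀ {n a} → Word S (suc n) a → IsWord G S (suc n) a
  toIsWord w = s≤s z≤n , w

-- The linear identity that balances the two sides in the (⇐) direction:
-- with k = n′ + n and l = m + m′ both sides equal k (i+1) + l (j+1).
balance : ∀ m m′ n n′ i j →
  m + ((((m + m′) * j) + ((n′ + n) * suc i)) + m′) ≡ (n′ + (((n′ + n) * i) + ((m + m′) * suc j))) + n
balance = solve-∀

module TwoSidedDigraph {c ℓ p q} (G : Group c ℓ) (L : Pred (Group.Carrier G) p) (R : Pred (Group.Carrier G) q) where
  open Group G
  open Words G
  open import Algebra.Properties.Group G using (inverseˡ-unique; y≈x\\z; \\-leftDividesʳ)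
  open import Relation.Binary.Reasoning.Setoid setoid

  Reach : ℕ → ℕ → Carrier → Carrier → Set (c ⊔ ℓ ⊔ p ⊔ q)
  Reach u v g h = Σ Carrier λ a → Σ Carrier λ b → Word (Inv G L) u a × Word R v b × h ≈ (a ∙ g) ∙ b

  Loop : ℕ → ℕ → Set (c ⊔ ℓ ⊔ p ⊔ q)
  Loop u v = Reach u v ε ε

  Reach-refl : ∀ {g h} → g ≈ h → Reach 0 0 g h
  Reach-refl g≈h = ε , ε , Word-ε , Word-ε , trans (sym g≈h) (sym (trans (identityʳ _) (identityˡ _)))

  Reach-cast : ∀ {u u′ v v′ g h} → u ≡ u′ → v ≡ v′ → Reach u v g h → Reach u′ v′ g h
  Reach-cast P.refl P.refl r = r

  Reach-trans : ∀ {u v u′ v′ g h k} → Reach u v g h → Reach u′ v′ h k → Reach (u′ + u) (v + v′) g k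
  Reach-trans {g = g} {h} {k} (a , b , wa , wb , h≈) (a′ , b′ , wa′ , wb′ , k≈) =
    a′ ∙ a , b ∙ b′ , Word-++ wa′ wa , Word-++ wb wb′ , k≈a′agbb′
    where
    k≈a′agbb′ : k ≈ ((a′ ∙ a) ∙ g) ∙ (b ∙ b′)
    k≈a′agbb′ = begin
      k                           ≈⟨ k≈ ⟩
      (a′ ∙ h) ∙ b′               ≈⟨ ∙-congʳ (∙-congˡ h≈) ⟩
      (a′ ∙ ((a ∙ g) ∙ b)) ∙ b′   ≈⟨ solve monoid ⟩
      ((a′ ∙ a) ∙ g) ∙ (b ∙ b′)   ∎

  Arc⇒Reach : ∀ {g h} → Arc G L R g h → Reach 1 1 g h
  Arc⇒Reach (l , r , Ll , Rr , h≈) =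
    l ⁻¹ , r , Word-letter (l , Ll , refl) , Word-letter Rr , h≈

  Reach-step : ∀ {n g h k} → Arc G L R g h → Reach n n h k → Reach (suc n) (suc n) g k
  Reach-step {n} arc r = Reach-cast (+-comm n 1) P.refl (Reach-trans (Arc⇒Reach arc) r)

  -- peeling the innermost letters l⁻¹ and r off a balanced relation yields its first arc
  Reach-uncons : ∀ {n g h} → Reach (suc n) (suc n) g h →
                 Σ Carrier λ g′ → Arc G L R g g′ × Reach n n g′ h
  Reach-uncons {g = g} {h} (a , b , wa , (y ∷ ys , Ry ∷ Rys , b≈) , h≈) with Word-unsnoc wa
  ... | a′ , x , wa′ , (l , Ll , x≈l⁻¹) , a≈ =
    (l ⁻¹ ∙ g) ∙ y , (l , y , Ll , Ry , refl) , a′ , prod G ys , wa′ , (ys , Rys , refl) , h≈′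
    where
    h≈′ : h ≈ (a′ ∙ ((l ⁻¹ ∙ g) ∙ y)) ∙ prod G ys
    h≈′ = begin
      h                                  ≈⟨ h≈ ⟩
      (a ∙ g) ∙ b                        ≈⟨ ∙-cong (∙-congʳ (trans a≈ (∙-congˡ x≈l⁻¹))) b≈ ⟩
      ((a′ ∙ l ⁻¹) ∙ g) ∙ (y ∙ prod G ys) ≈⟨ solve monoid ⟩
      (a′ ∙ ((l ⁻¹ ∙ g) ∙ y)) ∙ prod G ys ∎

  Path⇒Reach : ∀ {g h} → Path G L R g h → Σ ℕ λ n → Reach n n g h
  Path⇒Reach (here g≈h)    = 0 , Reach-refl g≈h
  Path⇒Reach (step arc pth) with Path⇒Reach pth
  ... | n , r = suc n , Reach-step arc r

  Reach⇒Path : ∀ n {g h} → Reach n n g h → Path G L R g h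
  Reach⇒Path zero    (a , b , ([] , [] , a≈ε) , ([] , [] , b≈ε) , h≈) =
    here (sym (trans h≈ (trans (∙-cong (∙-congʳ a≈ε) b≈ε) (trans (identityʳ _) (identityˡ _)))))
  Reach⇒Path (suc n) r with Reach-uncons r
  ... | g′ , arc , r′ = step arc (Reach⇒Path n r′)

  IdentityPair : ℕ → ℕ → Set (c ⊔ ℓ ⊔ p ⊔ q)
  IdentityPair u v = Σ Carrier λ x → Σ Carrier λ y →
    IsWord G (Inv G L) u x × IsWord G R v y × x ∙ y ≈ ε

  IdentityPair⇒Loop : ∀ {u v} → IdentityPair u v → Loop u v
  IdentityPair⇒Loop (x , y , (_ , wx) , (_ , wy) , xy≈ε) =
    x , y , wx , wy , sym (trans (∙-congʳ (identityʳ x)) xy≈ε)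

  Loop⇒IdentityPair : ∀ {u v} → Loop (suc u) (suc v) → IdentityPair (suc u) (suc v)
  Loop⇒IdentityPair (x , y , wx , wy , ε≈) =
    x , y , toIsWord wx , toIsWord wy , trans (∙-congʳ (sym (identityʳ x))) (sym ε≈)

  Loop-power : ∀ {u v} → Loop u v → ∀ k → Loop (k * u) (k * v)
  Loop-power loop zero    = Reach-refl refl
  Loop-power {u} loop (suc k) = Reach-cast (+-comm (k * u) u) P.refl (Reach-trans loop (Loop-power loop k))

  Reach⇒factorˡ : ∀ {m n h} → Reach (suc m) (suc n) ε h → (_·_ G (𝒲 G (Inv G L)) (𝒲 G R)) h
  Reach⇒factorˡ (a , b , wa , wb , h≈) =
    a , b , (_ , toIsWord wa) , (_ , toIsWord wb) , trans h≈ (∙-congʳ (identityʳ a))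

  factorˡ⇒Reach : ∀ {h} → (_·_ G (𝒲 G (Inv G L)) (𝒲 G R)) h → Σ ℕ λ m → Σ ℕ λ n → Reach m n ε h
  factorˡ⇒Reach (a , b , (m , _ , wa) , (n , _ , wb) , h≈) =
    m , n , a , b , wa , wb , trans h≈ (∙-congʳ (sym (identityʳ a)))

  Reach⇒factorʳ : ∀ {m n g} → Reach (suc m) (suc n) g ε → (_·_ G (𝒲 G L) (𝒲 G (Inv G R))) g
  Reach⇒factorʳ {g = g} (a , b , wa , wb , ε≈) =
    a ⁻¹ , b ⁻¹ , (_ , toIsWord (Word-inv uninv-letter wa)) , (_ , toIsWord (Word-inv inv-letter wb)) ,
    y≈x\\z a g (b ⁻¹) (inverseˡ-unique (a ∙ g) b (sym ε≈))

  factorʳ⇒Reach : ∀ {g} → (_·_ G (𝒲 G L) (𝒲 G (Inv G R))) g → Σ ℕ λ m → Σ ℕ λ n → Reach m n g ε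
  factorʳ⇒Reach {g} (a , b , (m , _ , wa) , (n , _ , wb) , g≈) =
    m , n , a ⁻¹ , b ⁻¹ , Word-inv inv-letter wa , Word-inv uninv-letter wb , sym cancels
    where
    cancels : (a ⁻¹ ∙ g) ∙ b ⁻¹ ≈ ε
    cancels = trans (∙-congʳ (trans (∙-congˡ g≈) (\\-leftDividesʳ a b))) (inverseʳ b)

  -- (⇐): pad g ⇝ e ⇝ h with (n′+n) copies of the first loop and (m+m′) of the second
  connect-via-ε : ∀ {i j m m′ n n′ g h} → Loop (suc i) i → Loop j (suc j) →
                  Reach m′ n′ g ε → Reach m n ε h → Path G L R g h
  connect-via-ε {i} {j} {m} {m′} {n} {n′} loopᵢ loopⱼ g⇝ε ε⇝h =
    Reach⇒Path _ (Reach-cast (balance m m′ n n′ i j) P.refl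
      (Reach-trans (Reach-trans g⇝ε (Reach-trans (Loop-power loopᵢ (n′ + n)) (Loop-power loopⱼ (m + m′)))) ε⇝h))

  module Connected (sc : StronglyConnected G L R) {l r : Carrier} (Ll : L l) (Rr : R r) where

    Reach⁺ : ∀ g h → Σ ℕ λ n → Reach (suc n) (suc n) g h
    Reach⁺ g h with Path⇒Reach (sc ((l ⁻¹ ∙ g) ∙ r) h)
    ... | n , rest = n , Reach-step (l , r , Ll , Rr , refl) rest

    -- l⁻¹ · l · e = e and e · r⁻¹ · r = e close the paths e → l and e → r⁻¹ into loops
    Reach-l : Reach 1 0 l ε
    Reach-l = l ⁻¹ , ε , Word-letter (l , Ll , refl) , Word-ε , sym (trans (identityʳ _) (inverseˡ l))

    Reach-r⁻¹ : Reach 0 1 (r ⁻¹) ε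
    Reach-r⁻¹ = ε , r , Word-ε , Word-letter Rr , sym (trans (∙-congʳ (identityˡ _)) (inverseˡ r))

    loop-longer-left : Σ ℕ λ i → IdentityPair (suc i) i
    loop-longer-left with Reach⁺ ε l
    ... | n , ε⇝l = suc n , Loop⇒IdentityPair (Reach-cast P.refl (+-identityʳ (suc n)) (Reach-trans ε⇝l Reach-l))

    loop-longer-right : Σ ℕ λ j → IdentityPair j (suc j)
    loop-longer-right with Reach⁺ ε (r ⁻¹)
    ... | n , ε⇝r⁻¹ = suc n , Loop⇒IdentityPair (Reach-cast P.refl (+-comm (suc n) 1) (Reach-trans ε⇝r⁻¹ Reach-r⁻¹))

  Conditions : Set (c ⊔ ℓ ⊔ p ⊔ q)
  Conditions = IsAll G (_·_ G (𝒲 G (Inv G L)) (𝒲 G R)) × IsAll G (_·_ G (𝒲 G L) (𝒲 G (Inv G R)))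
             × (Σ ℕ λ i → IdentityPair (suc i) i) × (Σ ℕ λ j → IdentityPair j (suc j))

  necessary : ∀ {l r} → L l → R r → StronglyConnected G L R → Conditions
  necessary Ll Rr sc =
    (λ h → Reach⇒factorˡ (proj₂ (Reach⁺ ε h))) , (λ g → Reach⇒factorʳ (proj₂ (Reach⁺ g ε))) ,
    loop-longer-left , loop-longer-right
    where open Connected sc Ll Rr

  sufficient : Conditions → StronglyConnected G L R
  sufficient (factorsˡ , factorsʳ , (_ , pairᵢ) , (_ , pairⱼ)) g h
    with factorʳ⇒Reach (factorsʳ g) | factorˡ⇒Reach (factorsˡ h)
  ... | _ , _ , g⇝ε | _ , _ , ε⇝h =
    connect-via-ε (IdentityPair⇒Loop pairᵢ) (IdentityPair⇒Loop pairⱼ) g⇝ε ε⇝h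

theorem2p4 : ∀ {c ℓ p q} (G : Group c ℓ) (L : Pred (Group.Carrier G) p) (R : Pred (Group.Carrier G) q) →
    Σ (Group.Carrier G) L → Σ (Group.Carrier G) R →
    StronglyConnected G L R ⇔
      ( IsAll G (_·_ G (𝒲 G (Inv G L)) (𝒲 G R))
      × IsAll G (_·_ G (𝒲 G L) (𝒲 G (Inv G R)))
      × Σ ℕ (λ i → Σ (Group.Carrier G) λ x → Σ (Group.Carrier G) λ y →
          IsWord G (Inv G L) (suc i) x × IsWord G R i y × Group._≈_ G (Group._∙_ G x y) (Group.ε G))
      × Σ ℕ (λ j → Σ (Group.Carrier G) λ x → Σ (Group.Carrier G) λ y →
          IsWord G (Inv G L) j x × IsWord G R (suc j) y × Group._≈_ G (Group._∙_ G x y) (Group.ε G)) )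
theorem2p4 G L R (_ , Ll) (_ , Rr) = mk⇔ (necessary Ll Rr) sufficient
  where open TwoSidedDigraph G L R
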